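{- Let $i\ge1$, $k$ with $i+1\le k\le 2^i$, and let $f:[k-1]\to\mathcal{P}([i])\setminus\{\emptyset\}$ be an $(i,k)$-prototype. Suppose there exist $n\ge1$ and a partition $\pi=\{P_1,\dots,P_k\}$ of $[n+1]$ into $k$ nonempty blocks such that the set of hyperplanes $\{H_{A_1},\dots,H_{A_i}\}$, where $(A_1,\dots,A_i)=A_{f,\pi}$, is a broken circuit of $\mathcal{A}_n$ (with respect to the binary order). Then for every $\tilde n\ge1$ and every partition $\tilde\pi=\{\tilde P_1,\dots,\tilde P_k\}$ of $[\tilde n+1]$ into $k$ nonempty blocks, the set $\{H_{\tilde A_1},\dots,H_{\tilde A_i}\}$, where $(\tilde A_1,\dots,\tilde A_i)=A_{f,\tilde\pi}$, is a broken circuit of $\mathcal{A}_{\tilde n}$ (with respect to the binary order).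
   Context: $\mathcal{A}_n$ is the resonance arrangement in $\mathbb{R}^n$ consisting of the hyperplanes $H_I=\{x:\sum_{i\in I}x_i=0\}$, $\emptyset\ne I\subseteq[n]$, with normal vectors $\chi_I$. Binary order: subsets $I$ of a finite set of positive integers are ordered by the integer $\sum_{i\in I}2^i$; this orders the hyperplanes $H_I$ of $\mathcal{A}_n$. A circuit of an arrangement is a minimally dependent set of hyperplanes (their normal vectors are linearly dependent, but every proper subset is independent); a broken circuit is $C\setminus\{H\}$ where $C$ is a circuit and $H$ its largest element in the given order. An $(i,k)$-prototype is an injective map $f:[k-1]\to\mathcal{P}([i])\setminus\{\emptyset\}$; its building blocks are $I_j^f=\{\ell\in[k-1]: j\in f(\ell)\}$ for $1\le j\le i$. For a partition $\pi$ of $[n+1]$ into $k$ nonempty blocks, the blocks are labelled $P_1,\dots,P_k$ increasingly in the binary order (so $n+1\in P_k$), and $A_{f,\pi}=(A_1,\dots,A_i)$ with $A_j=\bigcup_{\ell\in I_j^f}P_\ell\subseteq[n]$. -}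

module Defs where

open import Data.Bool using (Bool; true; false; if_then_else_; _∧_; _∨_)
open import Data.Nat using (ℕ; zero; suc; _+_; _^_; _≤_; _<_; _≡ᵇ_)
open import Data.Fin using (Fin; toℕ; inject₁) renaming (zero to fzero; suc to fsuc)
open import Data.Fin.Subset using (Subset; _∈_; Nonempty)
open import Data.Vec using (lookup; tabulate)
open import Data.List using (List; length)
import Data.List as L
open import Data.List.Membership.Propositional renaming (_∈_ to _∈ˡ_)
open import Data.List.Relation.Unary.All using (All)
open import Data.List.Relation.Unary.Unique.Propositional using (Unique)
open import Data.List.Relation.Binary.Sublist.Propositional using () renaming (_⊆_ to _⊑_)
open import Data.Rational using (ℚ; 0ℚ; 1ℚ) renaming (_+_ to _+ℚ_; _*_ to _*ℚ_)
open import Data.Product using (Σ; ∃; _×_; _,_)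
open import Function.Definitions using (Injective)
open import Relation.Binary.PropositionalEquality using (_≡_; _≢_)
open import Relation.Nullary using (¬_)

-- Conventions: [n] = {1,…,n} is represented by Fin n, the element x : Fin n
-- standing for the integer toℕ x + 1.  Subsets of [n] are Subset n = Vec Bool n.

sumℕ : (m : ℕ) → (Fin m → ℕ) → ℕ
sumℕ zero    g = 0
sumℕ (suc m) g = g fzero + sumℕ m (λ x → g (fsuc x))

sumℚ : (m : ℕ) → (Fin m → ℚ) → ℚ
sumℚ zero    g = 0ℚ
sumℚ (suc m) g = g fzero +ℚ sumℚ m (λ x → g (fsuc x))

anyFin : (m : ℕ) → (Fin m → Bool) → Bool
anyFin zero    g = false
anyFin (suc m) g = g fzero ∨ anyFin m (λ x → g (fsuc x))

-- binary order: I ↦ Σ_{a ∈ I} 2^a  (element x : Fin m is the integer toℕ x + 1)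
binVal : {m : ℕ} → Subset m → ℕ
binVal {m} I = sumℕ m (λ x → if lookup I x then 2 ^ (toℕ x + 1) else 0)

χ : {n : ℕ} → Subset n → Fin n → ℚ
χ I x = if lookup I x then 1ℚ else 0ℚ

Dependent : {n : ℕ} → List (Subset n) → Set
Dependent {n} C =
  Σ (Fin (length C) → ℚ) λ c →
    (∃ λ j → c j ≢ 0ℚ) ×
    (∀ (x : Fin n) → sumℚ (length C) (λ j → c j *ℚ χ (L.lookup C j) x) ≡ 0ℚ)

IsCircuit : {n : ℕ} → List (Subset n) → Set
IsCircuit C =
  Unique C × All Nonempty C × Dependent C ×
  (∀ S → S ⊑ C → length S Data.Nat.< length C → ¬ Dependent S)

-- The set { H_I : I ∈ B } (B read as a set, repetitions allowed) is a broken
-- circuit of 𝒜_n w.r.t. the binary order: it equals C ∖ {H} for a circuit C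
-- whose largest element (binary order) is H.
IsBrokenCircuit : (n : ℕ) → List (Subset n) → Set
IsBrokenCircuit n B =
  Σ (List (Subset n)) λ C → Σ (Subset n) λ H →
    IsCircuit C × H ∈ˡ C × (∀ X → X ∈ˡ C → binVal X ≤ binVal H) ×
    (∀ X → (X ∈ˡ B → X ∈ˡ C × X ≢ H) × (X ∈ˡ C → X ≢ H → X ∈ˡ B))

IsPrototype : {i : ℕ} (k : ℕ) → (Fin (k Data.Nat.∸ 1) → Subset i) → Set
IsPrototype k f = Injective _≡_ _≡_ f × (∀ ℓ → Nonempty (f ℓ))

-- A partition π of [n+1] into k nonempty blocks with its binary labelling
-- P_1,…,P_k is encoded as p : [n+1] → [k] (p a = ℓ iff a ∈ P_ℓ) which is
-- surjective and whose blocks increase in the binary order.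
block : {n k : ℕ} → (Fin (suc n) → Fin k) → Fin k → Subset (suc n)
block p ℓ = tabulate λ a → toℕ (p a) ≡ᵇ toℕ ℓ

IsLabelledPartition : {n k : ℕ} → (Fin (suc n) → Fin k) → Set
IsLabelledPartition {n} {k} p =
  (∀ (ℓ : Fin k) → ∃ λ a → p a ≡ ℓ) ×
  (∀ (ℓ ℓ' : Fin k) → toℕ ℓ < toℕ ℓ' → binVal (block p ℓ) < binVal (block p ℓ'))

-- A_{f,π} = (A_1,…,A_i),  A_j = ⋃_{ℓ ∈ I_j^f} P_ℓ ⊆ [n],  I_j^f = {ℓ ∈ [k-1] : j ∈ f ℓ}
Aj : {i k n : ℕ} → (Fin (k Data.Nat.∸ 1) → Subset i) → (Fin (suc n) → Fin k) →
     Fin i → Subset n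
Aj {i} {k} {n} f p j = tabulate λ x →
  anyFin (k Data.Nat.∸ 1) (λ ℓ → lookup (f ℓ) j ∧ (toℕ (p (inject₁ x)) ≡ᵇ toℕ ℓ))

Afπ : {i k n : ℕ} → (Fin (k Data.Nat.∸ 1) → Subset i) → (Fin (suc n) → Fin k) →
      List (Subset n)
Afπ {i} f p = L.tabulate {n = i} (Aj f p)

module Submission where

-- Fix a labelled partition p of [n+1] into k = K+1 blocks.  A subset of
-- [n] that is a union of blocks (a "saturated" set) is the realisation of a
-- label L : [k] → Bool with L k = false; every A_j is of this form, with the
-- building block I_j^f as its label.  Between two labelled partitions p and p̃
-- we transport saturated sets by keeping the label, T = realise p̃ ∘ label p.
-- The proof rests on three facts, each independent of the partition:
--   (1) binary order: the blocks increase in the binary order, so the larger of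
--       two unions of blocks is decided by the highest block where their labels
--       differ; hence T preserves the binary order;
--   (2) linear algebra: the coordinates of T X are coordinates of X (or the
--       dummy coordinate n+1, which is 0), so T and its inverse preserve linear
--       dependence, and T maps circuits of saturated sets to circuits;
--   (3) the largest element H of a circuit C whose other members are saturated
--       is saturated too: its coefficient in the circuit relation is nonzero.
-- Hence T carries the broken circuit C ∖ {H} = A_{f,p} to a broken circuit
-- T C ∖ {T H}, which is A_{f,p̃}.

open import Defs
open import Data.Nat using (ℕ; suc; _+_; _^_; _≤_; _∸_)
open import Data.Fin using (Fin)
open import Data.Fin.Subset using (Subset)
open import Data.Product using (Σ; _×_)

open import Data.Bool using (Bool; true; false; if_then_else_; _∧_)
open import Data.Bool.Properties using (∧-zeroʳ; T-≡) renaming (_≟_ to _≟ᵇ_)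
open import Data.Nat using (zero; _*_; _<_; _≡ᵇ_; z≤n; s≤s)
open import Data.Nat.Properties
open import Data.Nat.Tactic.RingSolver using (solve-∀)
open import Data.Fin using (toℕ; inject₁; fromℕ) renaming (zero to fzero; suc to fsuc)
open import Data.Fin.Properties using (toℕ-injective; toℕ-fromℕ; toℕ<n; toℕ≤pred[n]) renaming (suc-injective to fsuc-injective)
open import Data.Fin.Subset using (Nonempty)
open import Data.Vec using ([]; _∷_; lookup; tabulate)
open import Data.Vec.Properties using (lookup∘tabulate; tabulate∘lookup; tabulate-cong; []=⇒lookup; lookup⇒[]=; ≡-dec)
import Data.Vec.Functional as Vector
open import Data.List using (List; length) renaming ([] to []ˡ; _∷_ to _∷ˡ_)
import Data.List as L
import Data.List.Properties as LP
open import Data.List.Membership.Propositional renaming (_∈_ to _∈ˡ_)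
open import Data.List.Membership.Propositional.Properties using (∈-map⁺; ∈-map⁻; ∈-tabulate⁻; ∈-lookup)
open import Data.List.Relation.Unary.Any using (index)
open import Data.List.Relation.Unary.Any.Properties using (lookup-index)
import Data.List.Relation.Unary.All as All
import Data.List.Relation.Unary.All.Properties as AllP
open import Data.List.Relation.Unary.AllPairs using (_∷_)
open import Data.List.Relation.Unary.Unique.Propositional using (Unique)
import Data.List.Relation.Unary.Unique.Propositional.Properties as UniqueP
open import Data.List.Relation.Binary.Sublist.Propositional using (⊆-refl) renaming (_⊆_ to _⊑_)
open import Data.List.Relation.Binary.Sublist.Propositional.Properties using (Any-resp-⊆)
open import Data.List.Relation.Binary.Sublist.Heterogeneous using ([]; _∷ʳ_; _∷_)
open import Data.Product using (∃; _,_; proj₁; proj₂)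
open import Data.Sum using (_⊎_; inj₁; inj₂)
open import Data.Empty using (⊥-elim)
open import Function using (_∘_; _⇔_; mk⇔; Equivalence)
open import Relation.Binary.PropositionalEquality
open import Relation.Binary using (tri<; tri≈; tri>)
open import Relation.Nullary using (¬_; yes; no)
open import Data.Rational using (ℚ; 0ℚ; 1ℚ) renaming (_+_ to _+ℚ_; _*_ to _*ℚ_)
import Data.Rational.Properties as ℚP


data TopOrInner (n : ℕ) : Fin (suc n) → Set where
  top   : TopOrInner n (fromℕ n)
  inner : (x : Fin n) → TopOrInner n (inject₁ x)

topOrInner : ∀ {n} (a : Fin (suc n)) → TopOrInner n a
topOrInner {zero}  fzero    = top
topOrInner {suc n} fzero    = inner fzero
topOrInner {suc n} (fsuc a) with topOrInner a
... | top     = top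
... | inner x = inner (fsuc x)

extend : ∀ {n} → Subset n → Fin (suc n) → Bool
extend []      fzero    = false
extend (b ∷ X) fzero    = b
extend (b ∷ X) (fsuc a) = extend X a

extend-inner : ∀ {n} (X : Subset n) (x : Fin n) → extend X (inject₁ x) ≡ lookup X x
extend-inner (b ∷ X) fzero    = refl
extend-inner (b ∷ X) (fsuc x) = extend-inner X x

extend-top : ∀ {n} (X : Subset n) → extend X (fromℕ n) ≡ false
extend-top []      = refl
extend-top (b ∷ X) = extend-top X

true≢false : true ≢ false
true≢false ()

extend-nonempty : ∀ {n} (X : Subset n) a → extend X a ≡ true → Nonempty X
extend-nonempty X a a∈X with topOrInner a
... | top     = ⊥-elim (true≢false (trans (sym a∈X) (extend-top X)))
... | inner x = x , lookup⇒[]= x X (trans (sym (extend-inner X x)) a∈X)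


-- Binary values and their lexicographic comparison

bit : Bool → ℕ
bit true  = 1
bit false = 0

bit≤1 : ∀ b → bit b ≤ 1
bit≤1 true  = s≤s z≤n
bit≤1 false = z≤n

value : (N : ℕ) → (Fin N → Bool) → ℕ
value zero    g = 0
value (suc N) g = bit (g fzero) + 2 * value N (g ∘ fsuc)

value-cong : ∀ N {g h : Fin N → Bool} → (∀ a → g a ≡ h a) → value N g ≡ value N h
value-cong zero    g≗h = refl
value-cong (suc N) g≗h = cong₂ (λ b v → bit b + 2 * v) (g≗h fzero) (value-cong N (g≗h ∘ fsuc))

sumℕ-cong : ∀ m {g h : Fin m → ℕ} → (∀ a → g a ≡ h a) → sumℕ m g ≡ sumℕ m h
sumℕ-cong zero    g≗h = refl
sumℕ-cong (suc m) g≗h = cong₂ _+_ (g≗h fzero) (sumℕ-cong m (g≗h ∘ fsuc))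

lowest-digit : ∀ b x V → (if b then x else 0) + 2 * x * V ≡ x * (bit b + 2 * V)
lowest-digit true  x V = one-digit x V
  where one-digit : ∀ x V → x + 2 * x * V ≡ x * (1 + 2 * V)
        one-digit = solve-∀
lowest-digit false x V = zero-digit x V
  where zero-digit : ∀ x V → 2 * x * V ≡ x * (2 * V)
        zero-digit = solve-∀

weighted-sum≡value : ∀ m e (g : Fin m → Bool) →
  sumℕ m (λ x → if g x then 2 ^ (toℕ x + e) else 0) ≡ 2 ^ e * value m g
weighted-sum≡value zero    e g = sym (*-zeroʳ (2 ^ e))
weighted-sum≡value (suc m) e g = begin
  lowest + sumℕ m (λ x → if g (fsuc x) then 2 ^ (suc (toℕ x) + e) else 0)
    ≡⟨ cong (lowest +_) (sumℕ-cong m (λ x → cong (λ t → if g (fsuc x) then 2 ^ t else 0) (sym (+-suc (toℕ x) e)))) ⟩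
  lowest + sumℕ m (λ x → if g (fsuc x) then 2 ^ (toℕ x + suc e) else 0)
    ≡⟨ cong (lowest +_) (weighted-sum≡value m (suc e) (g ∘ fsuc)) ⟩
  lowest + 2 ^ suc e * value m (g ∘ fsuc)
    ≡⟨ lowest-digit (g fzero) (2 ^ e) (value m (g ∘ fsuc)) ⟩
  2 ^ e * value (suc m) g ∎
  where
  open ≡-Reasoning
  lowest : ℕ
  lowest = if g fzero then 2 ^ e else 0

binVal≡value : ∀ {m} (X : Subset m) → binVal X ≡ 2 * value m (lookup X)
binVal≡value {m} X = weighted-sum≡value m 1 (lookup X)

value-extend : ∀ {n} (X : Subset n) → value (suc n) (extend X) ≡ value n (lookup X)
value-extend []      = refl
value-extend (b ∷ X) = cong (λ v → bit b + 2 * v) (value-extend X)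

binVal≡value-extend : ∀ {n} (X : Subset n) → binVal X ≡ 2 * value (suc n) (extend X)
binVal≡value-extend X = trans (binVal≡value X) (cong (2 *_) (sym (value-extend X)))

LexLtAt : ∀ {N} → (Fin N → Bool) → (Fin N → Bool) → Fin N → Set
LexLtAt g h w = g w ≡ false × h w ≡ true × (∀ z → toℕ w < toℕ z → g z ≡ h z)

lex⇒value< : ∀ N {g h : Fin N → Bool} w → LexLtAt g h w → value N g < value N h
lex⇒value< (suc N) {g} {h} fzero (gw , hw , above)
  rewrite gw | hw | value-cong N {g ∘ fsuc} {h ∘ fsuc} (λ z → above (fsuc z) (s≤s z≤n)) = n<1+n _
lex⇒value< (suc N) {g} {h} (fsuc w) (gw , hw , above) = begin-strict
  bit (g fzero) + 2 * Vg ≤⟨ +-monoˡ-≤ (2 * Vg) (bit≤1 (g fzero)) ⟩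
  1 + 2 * Vg             <⟨ n<1+n (1 + 2 * Vg) ⟩
  2 + 2 * Vg             ≡⟨ sym (*-suc 2 Vg) ⟩
  2 * suc Vg             ≤⟨ *-monoʳ-≤ 2 higher ⟩
  2 * Vh                 ≤⟨ m≤n+m (2 * Vh) (bit (h fzero)) ⟩
  bit (h fzero) + 2 * Vh ∎
  where
  open ≤-Reasoning
  Vg = value N (g ∘ fsuc)
  Vh = value N (h ∘ fsuc)
  higher : Vg < Vh
  higher = lex⇒value< N w (gw , hw , λ z w<z → above (fsuc z) (s≤s w<z))

lex-trichotomy : ∀ N (g h : Fin N → Bool) →
  (∀ z → g z ≡ h z) ⊎ (∃ (LexLtAt g h) ⊎ ∃ (LexLtAt h g))
lex-trichotomy zero    g h = inj₁ (λ ())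
lex-trichotomy (suc N) g h with lex-trichotomy N (g ∘ fsuc) (h ∘ fsuc)
... | inj₂ (inj₁ (w , gw , hw , above)) = inj₂ (inj₁ (fsuc w , gw , hw , shift above))
  where shift : _ → ∀ z → toℕ (fsuc w) < toℕ z → g z ≡ h z
        shift above (fsuc z) (s≤s w<z) = above z w<z
... | inj₂ (inj₂ (w , hw , gw , above)) = inj₂ (inj₂ (fsuc w , hw , gw , shift above))
  where shift : _ → ∀ z → toℕ (fsuc w) < toℕ z → h z ≡ g z
        shift above (fsuc z) (s≤s w<z) = above z w<z
... | inj₁ higher-equal with g fzero in g0 | h fzero in h0
...   | true  | true  = inj₁ λ { fzero → trans g0 (sym h0) ; (fsuc z) → higher-equal z }
...   | false | false = inj₁ λ { fzero → trans g0 (sym h0) ; (fsuc z) → higher-equal z }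
...   | false | true  = inj₂ (inj₁ (fzero , g0 , h0 , λ { (fsuc z) _ → higher-equal z }))
...   | true  | false = inj₂ (inj₂ (fzero , h0 , g0 , λ { (fsuc z) _ → sym (higher-equal z) }))

lex-asym : ∀ {N} {g h : Fin N → Bool} {w w'} → LexLtAt g h w → ¬ LexLtAt h g w'
lex-asym {w = w} {w'} (gw , hw , above) (hw' , gw' , above') with <-cmp (toℕ w) (toℕ w')
... | tri< lt _ _ = true≢false (trans (sym gw') (trans (above _ lt) hw'))
... | tri≈ _ eq _ rewrite toℕ-injective eq = true≢false (trans (sym gw') gw)
... | tri> _ _ gt = true≢false (trans (sym hw) (trans (above' _ gt) gw))

≡ᵇ⇒≡′ : ∀ {m n} → (m ≡ᵇ n) ≡ true → m ≡ n
≡ᵇ⇒≡′ {m} {n} e = ≡ᵇ⇒≡ m n (Equivalence.from T-≡ e)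

≡ᵇ-refl : ∀ m → (m ≡ᵇ m) ≡ true
≡ᵇ-refl m = Equivalence.to T-≡ (≡⇒≡ᵇ m m refl)


-- A labelled partition p of [n+1] into K+1 blocks

-- A label selects a set of blocks; its realisation is their union, read in [n].
realise : ∀ {K n} → (Fin (suc n) → Fin (suc K)) → (Fin (suc K) → Bool) → Subset n
realise p L = tabulate (λ x → L (p (inject₁ x)))

module LabelledPartition {K n : ℕ} (p : Fin (suc n) → Fin (suc K)) (lp : IsLabelledPartition p) where

  rep : Fin (suc K) → Fin (suc n)
  rep m = proj₁ (proj₁ lp m)

  rep-ok : ∀ m → p (rep m) ≡ m
  rep-ok m = proj₂ (proj₁ lp m)

  inBlock : Fin (suc K) → Fin (suc n) → Bool
  inBlock m a = toℕ (p a) ≡ᵇ toℕ m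

  inBlock-self : ∀ a → inBlock (p a) a ≡ true
  inBlock-self a = ≡ᵇ-refl (toℕ (p a))

  inBlock⇒ : ∀ {m a} → inBlock m a ≡ true → p a ≡ m
  inBlock⇒ e = toℕ-injective (≡ᵇ⇒≡′ e)

  blocks-increasing : ∀ m m' → toℕ m < toℕ m' → value (suc n) (inBlock m) < value (suc n) (inBlock m')
  blocks-increasing m m' m<m' =
    *-cancelˡ-< 2 _ _ (subst₂ _<_ (binVal-block m) (binVal-block m') (proj₂ lp m m' m<m'))
    where
    binVal-block : ∀ m → binVal (block p m) ≡ 2 * value (suc n) (inBlock m)
    binVal-block m = trans (binVal≡value (block p m))
                           (cong (2 *_) (value-cong (suc n) (lookup∘tabulate (inBlock m))))

  -- Above every element of a block lies an element of each later block: the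
  -- most significant difference of the two blocks must belong to the later one.
  later-block-above : ∀ {m'} z → toℕ (p z) < toℕ m' → ∃ λ w → p w ≡ m' × toℕ z < toℕ w
  later-block-above {m'} z pz<m' with lex-trichotomy (suc n) (inBlock (p z)) (inBlock m')
  ... | inj₁ same =
    ⊥-elim (<-irrefl (cong toℕ (inBlock⇒ (trans (sym (same z)) (inBlock-self z)))) pz<m')
  ... | inj₂ (inj₂ (w , reversed)) =
    ⊥-elim (<-asym (lex⇒value< (suc n) w reversed) (blocks-increasing _ _ pz<m'))
  ... | inj₂ (inj₁ (w , z-block-out , m'-block-in , above)) with <-cmp (toℕ z) (toℕ w)
  ...   | tri< z<w _ _ = w , inBlock⇒ m'-block-in , z<w
  ...   | tri≈ _ z≡w _ = ⊥-elim (true≢false (begin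
            true                ≡⟨ sym (inBlock-self z) ⟩
            inBlock (p z) z     ≡⟨ cong (inBlock (p z)) (toℕ-injective z≡w) ⟩
            inBlock (p z) w     ≡⟨ z-block-out ⟩
            false               ∎))
    where open ≡-Reasoning
  ...   | tri> _ _ w<z =
    ⊥-elim (<-irrefl (cong toℕ (inBlock⇒ (trans (sym (above z w<z)) (inBlock-self z)))) pz<m')

  -- n+1 lies in the last block P_k: nothing can lie above it.
  top-in-last-block : p (fromℕ n) ≡ fromℕ K
  top-in-last-block with <-cmp (toℕ (p (fromℕ n))) K
  ... | tri≈ _ eq _ = toℕ-injective (trans eq (sym (toℕ-fromℕ K)))
  ... | tri> _ _ gt = ⊥-elim (<⇒≱ gt (toℕ≤pred[n] (p (fromℕ n))))
  ... | tri< lt _ _ with later-block-above (fromℕ n) (subst (toℕ (p (fromℕ n)) <_) (sym (toℕ-fromℕ K)) lt)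
  ...   | w , _ , top<w = ⊥-elim (<⇒≱ (subst (_< toℕ w) (toℕ-fromℕ n) top<w) (toℕ≤pred[n] w))

  lex-reflect : ∀ (L L' : Fin (suc K) → Bool) {w} → LexLtAt (L ∘ p) (L' ∘ p) w → LexLtAt L L' (p w)
  lex-reflect L L' {w} (Lw , L'w , above) = Lw , L'w , λ m' pw<m' →
    let (w' , pw'≡m' , w<w') = later-block-above w pw<m' in subst (λ u → L u ≡ L' u) pw'≡m' (above w' w<w')

  lex-push : ∀ (L L' : Fin (suc K) → Bool) {ℓ} → LexLtAt L L' ℓ → value (suc n) (L ∘ p) < value (suc n) (L' ∘ p)
  lex-push L L' {ℓ} lt@(Lℓ , L'ℓ , _) with lex-trichotomy (suc n) (L ∘ p) (L' ∘ p)
  ... | inj₁ same = ⊥-elim (true≢false (begin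
          true          ≡⟨ sym L'ℓ ⟩
          L' ℓ          ≡⟨ cong L' (sym (rep-ok ℓ)) ⟩
          L' (p (rep ℓ)) ≡⟨ sym (same (rep ℓ)) ⟩
          L (p (rep ℓ)) ≡⟨ cong L (rep-ok ℓ) ⟩
          L ℓ           ≡⟨ Lℓ ⟩
          false         ∎))
    where open ≡-Reasoning
  ... | inj₂ (inj₁ (w , lt')) = lex⇒value< (suc n) w lt'
  ... | inj₂ (inj₂ (w , gt))  = ⊥-elim (lex-asym lt (lex-reflect L' L gt))

  value≤⇔no-inversion : ∀ (L L' : Fin (suc K) → Bool) →
    value (suc n) (L ∘ p) ≤ value (suc n) (L' ∘ p) ⇔ (¬ ∃ (LexLtAt L' L))
  value≤⇔no-inversion L L' = mk⇔ to from
    where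
    to : value (suc n) (L ∘ p) ≤ value (suc n) (L' ∘ p) → ¬ ∃ (LexLtAt L' L)
    to le (ℓ , inversion) = <⇒≱ (lex-push L' L inversion) le
    from : ¬ ∃ (LexLtAt L' L) → value (suc n) (L ∘ p) ≤ value (suc n) (L' ∘ p)
    from no-inversion with lex-trichotomy (suc n) (L ∘ p) (L' ∘ p)
    ... | inj₁ same            = ≤-reflexive (value-cong (suc n) same)
    ... | inj₂ (inj₁ (w , lt)) = <⇒≤ (lex⇒value< (suc n) w lt)
    ... | inj₂ (inj₂ (w , gt)) = ⊥-elim (no-inversion (p w , lex-reflect L' L gt))

  label : Subset n → Fin (suc K) → Bool
  label X m = extend X (rep m)

  Saturated : Subset n → Set
  Saturated X = ∀ a → extend X a ≡ label X (p a)

  extend-realise : ∀ L → L (fromℕ K) ≡ false → ∀ a → extend (realise p L) a ≡ L (p a)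
  extend-realise L last a with topOrInner a
  ... | top     = trans (extend-top (realise p L)) (sym (trans (cong L top-in-last-block) last))
  ... | inner x = trans (extend-inner (realise p L) x) (lookup∘tabulate _ x)

  realise-saturated : ∀ L → L (fromℕ K) ≡ false → Saturated (realise p L)
  realise-saturated L last a = trans (extend-realise L last a)
    (trans (cong L (sym (rep-ok (p a)))) (sym (extend-realise L last (rep (p a)))))

  label-realise : ∀ L → L (fromℕ K) ≡ false → ∀ m → label (realise p L) m ≡ L m
  label-realise L last m = trans (extend-realise L last (rep m)) (cong L (rep-ok m))

  realise-label : ∀ X → Saturated X → realise p (label X) ≡ X
  realise-label X sat =
    trans (tabulate-cong (λ x → trans (sym (sat (inject₁ x))) (extend-inner X x))) (tabulate∘lookup X)

  label-last : ∀ X → Saturated X → label X (fromℕ K) ≡ false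
  label-last X sat = trans (cong (label X) (sym top-in-last-block)) (trans (sym (sat (fromℕ n))) (extend-top X))

  realise-nonempty : ∀ L {m} → L (fromℕ K) ≡ false → L m ≡ true → Nonempty (realise p L)
  realise-nonempty L {m} last Lm = extend-nonempty (realise p L) (rep m)
    (trans (extend-realise L last (rep m)) (trans (cong L (rep-ok m)) Lm))

  binVal-realise : ∀ L → L (fromℕ K) ≡ false → binVal (realise p L) ≡ 2 * value (suc n) (L ∘ p)
  binVal-realise L last = trans (binVal≡value-extend (realise p L)) (cong (2 *_) (value-cong (suc n) (extend-realise L last)))

realise-order-transport : ∀ {K n ñ} (p : Fin (suc n) → Fin (suc K)) (lp : IsLabelledPartition p)
  (p̃ : Fin (suc ñ) → Fin (suc K)) (lp̃ : IsLabelledPartition p̃) (L L' : Fin (suc K) → Bool) →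
  L (fromℕ K) ≡ false → L' (fromℕ K) ≡ false →
  binVal (realise p L) ≤ binVal (realise p L') → binVal (realise p̃ L) ≤ binVal (realise p̃ L')
realise-order-transport p lp p̃ lp̃ L L' last last' le =
  subst₂ _≤_ (sym (P̃.binVal-realise L last)) (sym (P̃.binVal-realise L' last'))
    (*-monoʳ-≤ 2 (Equivalence.from (P̃.value≤⇔no-inversion L L')
      (Equivalence.to (P.value≤⇔no-inversion L L')
        (*-cancelˡ-≤ 2 (subst₂ _≤_ (P.binVal-realise L last) (P.binVal-realise L' last') le)))))
  where
  module P  = LabelledPartition p lp
  module P̃ = LabelledPartition p̃ lp̃


-- Linear combinations of normal vectors

χᵇ : Bool → ℚ
χᵇ b = if b then 1ℚ else 0ℚ

combination : ∀ {n} (C : List (Subset n)) → (Fin (length C) → ℚ) → Fin n → ℚ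
combination C c x = sumℚ (length C) (λ j → c j *ℚ χ (L.lookup C j) x)

combinationᵉ : ∀ {n} (C : List (Subset n)) → (Fin (length C) → ℚ) → Fin (suc n) → ℚ
combinationᵉ C c a = sumℚ (length C) (λ j → c j *ℚ χᵇ (extend (L.lookup C j) a))

sumℚ-cong : ∀ m {g h : Fin m → ℚ} → (∀ a → g a ≡ h a) → sumℚ m g ≡ sumℚ m h
sumℚ-cong zero    g≗h = refl
sumℚ-cong (suc m) g≗h = cong₂ _+ℚ_ (g≗h fzero) (sumℚ-cong m (g≗h ∘ fsuc))

sumℚ-zero : ∀ m {g : Fin m → ℚ} → (∀ a → g a ≡ 0ℚ) → sumℚ m g ≡ 0ℚ
sumℚ-zero zero    g≗0 = refl
sumℚ-zero (suc m) g≗0 = trans (cong₂ _+ℚ_ (g≗0 fzero) (sumℚ-zero m (g≗0 ∘ fsuc))) (ℚP.+-identityʳ 0ℚ)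

combinationᵉ-vanishes : ∀ {n} (C : List (Subset n)) c → (∀ x → combination C c x ≡ 0ℚ) →
  ∀ a → combinationᵉ C c a ≡ 0ℚ
combinationᵉ-vanishes C c vanishes a with topOrInner a
... | top     = sumℚ-zero (length C) (λ j →
  trans (cong (λ b → c j *ℚ χᵇ b) (extend-top (L.lookup C j))) (ℚP.*-zeroʳ (c j)))
... | inner x = trans (sumℚ-cong (length C) (λ j →
  cong (λ b → c j *ℚ χᵇ b) (extend-inner (L.lookup C j) x))) (vanishes x)

sumℚ-exchange : ∀ m (g g' : Fin m → ℚ) (h : Fin m) → (∀ j → j ≢ h → g j ≡ g' j) →
  sumℚ m g +ℚ g' h ≡ sumℚ m g' +ℚ g h
sumℚ-exchange (suc m) g g' fzero agree = begin
  (g fzero +ℚ S) +ℚ g' fzero  ≡⟨ cong (λ t → (g fzero +ℚ t) +ℚ g' fzero) (sumℚ-cong m (λ j → agree (fsuc j) (λ ()))) ⟩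
  (g fzero +ℚ S') +ℚ g' fzero ≡⟨ ℚP.+-comm (g fzero +ℚ S') (g' fzero) ⟩
  g' fzero +ℚ (g fzero +ℚ S') ≡⟨ cong (g' fzero +ℚ_) (ℚP.+-comm (g fzero) S') ⟩
  g' fzero +ℚ (S' +ℚ g fzero) ≡⟨ sym (ℚP.+-assoc (g' fzero) S' (g fzero)) ⟩
  (g' fzero +ℚ S') +ℚ g fzero ∎
  where
  open ≡-Reasoning
  S  = sumℚ m (g ∘ fsuc)
  S' = sumℚ m (g' ∘ fsuc)
sumℚ-exchange (suc m) g g' (fsuc h) agree = begin
  (g fzero +ℚ S) +ℚ g' (fsuc h)  ≡⟨ ℚP.+-assoc (g fzero) S (g' (fsuc h)) ⟩
  g fzero +ℚ (S +ℚ g' (fsuc h))  ≡⟨ cong₂ _+ℚ_ (agree fzero (λ ())) (sumℚ-exchange m (g ∘ fsuc) (g' ∘ fsuc) h agree-tail) ⟩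
  g' fzero +ℚ (S' +ℚ g (fsuc h)) ≡⟨ sym (ℚP.+-assoc (g' fzero) S' (g (fsuc h))) ⟩
  (g' fzero +ℚ S') +ℚ g (fsuc h) ∎
  where
  open ≡-Reasoning
  S  = sumℚ m (g ∘ fsuc)
  S' = sumℚ m (g' ∘ fsuc)
  agree-tail : ∀ j → j ≢ h → g (fsuc j) ≡ g' (fsuc j)
  agree-tail j j≢h = agree (fsuc j) (λ sj≡sh → j≢h (fsuc-injective sj≡sh))

cancel-χᵇ : ∀ c u v → c ≢ 0ℚ → c *ℚ χᵇ u ≡ c *ℚ χᵇ v → u ≡ v
cancel-χᵇ c true  true  c≢0 e = refl
cancel-χᵇ c false false c≢0 e = refl
cancel-χᵇ c true  false c≢0 e = ⊥-elim (c≢0 (trans (sym (ℚP.*-identityʳ c)) (trans e (ℚP.*-zeroʳ c))))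
cancel-χᵇ c false true  c≢0 e = ⊥-elim (c≢0 (trans (sym (ℚP.*-identityʳ c)) (trans (sym e) (ℚP.*-zeroʳ c))))

drop-zero-coefficient : ∀ {n} (C : List (Subset n)) (c : Fin (length C) → ℚ) h → c h ≡ 0ℚ →
  Σ (List (Subset n)) λ S → S ⊑ C × length S < length C × Σ (Fin (length S) → ℚ) λ c' →
    (∀ x → combination S c' x ≡ combination C c x) × (∃ (λ j → c j ≢ 0ℚ) → ∃ λ j → c' j ≢ 0ℚ)
drop-zero-coefficient (X ∷ˡ C) c fzero c0≡0 = C , X ∷ʳ ⊆-refl , n<1+n (length C) , c ∘ fsuc , same , nontrivial
  where
  same : ∀ x → combination C (c ∘ fsuc) x ≡ combination (X ∷ˡ C) c x
  same x = sym (trans (cong (λ t → t *ℚ χ X x +ℚ combination C (c ∘ fsuc) x) c0≡0)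
    (trans (cong (_+ℚ combination C (c ∘ fsuc) x) (ℚP.*-zeroˡ (χ X x))) (ℚP.+-identityˡ _)))
  nontrivial : ∃ (λ j → c j ≢ 0ℚ) → ∃ λ j → c (fsuc j) ≢ 0ℚ
  nontrivial (fzero  , c0≢0) = ⊥-elim (c0≢0 c0≡0)
  nontrivial (fsuc j , cj≢0) = j , cj≢0
drop-zero-coefficient (X ∷ˡ C) c (fsuc h) ch≡0 with drop-zero-coefficient C (c ∘ fsuc) h ch≡0
... | S , S⊑C , shorter , c' , same , nontrivial =
  X ∷ˡ S , refl ∷ S⊑C , s≤s shorter , c fzero Vector.∷ c' , cong (c fzero *ℚ χ X _ +ℚ_) ∘ same , nontrivial'
  where
  nontrivial' : ∃ (λ j → c j ≢ 0ℚ) → ∃ λ j → (c fzero Vector.∷ c') j ≢ 0ℚ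
  nontrivial' (fzero  , c0≢0) = fzero , c0≢0
  nontrivial' (fsuc j , cj≢0) with nontrivial (j , cj≢0)
  ... | j' , c'j'≢0 = fsuc j' , c'j'≢0

-- In a circuit, every coefficient of a nontrivial vanishing combination is
-- nonzero: otherwise a proper subset would be dependent.
circuit-coefficient≢0 : ∀ {n} {C : List (Subset n)} → IsCircuit C → (c : Fin (length C) → ℚ) →
  ∃ (λ j → c j ≢ 0ℚ) → (∀ x → combination C c x ≡ 0ℚ) → ∀ h → c h ≢ 0ℚ
circuit-coefficient≢0 {C = C} (_ , _ , _ , minimal) c nontrivial vanishes h ch≡0
  with drop-zero-coefficient C c h ch≡0
... | S , S⊑C , shorter , c' , same , nontrivial' =
  minimal S S⊑C shorter (c' , nontrivial' nontrivial , λ x → trans (same x) (vanishes x))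

lookup-injective : ∀ {A : Set} {xs : List A} → Unique xs → ∀ i j → L.lookup xs i ≡ L.lookup xs j → i ≡ j
lookup-injective (_ ∷ _)      fzero    fzero    e = refl
lookup-injective (fresh ∷ _)  fzero    (fsuc j) e = ⊥-elim (All.lookup fresh (∈-lookup j) e)
lookup-injective (fresh ∷ _)  (fsuc i) fzero    e = ⊥-elim (All.lookup fresh (∈-lookup i) (sym e))
lookup-injective (_ ∷ unique) (fsuc i) (fsuc j) e = cong fsuc (lookup-injective unique i j e)

-- If a substitution r of coordinates of [n+1] leaves every member of a circuit
-- but H unchanged, it leaves H unchanged: in the circuit relation at a and at
-- r a only the terms of H differ, and H has a nonzero coefficient.
circuit-member-invariant : ∀ {n} (r : Fin (suc n) → Fin (suc n)) {C : List (Subset n)} {H : Subset n} →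
  IsCircuit C → H ∈ˡ C → (∀ X → X ∈ˡ C → X ≢ H → ∀ a → extend X a ≡ extend X (r a)) →
  ∀ a → extend H a ≡ extend H (r a)
circuit-member-invariant r {C} {H} circuit@(unique , _ , (c , nontrivial , vanishes) , _) H∈C others a =
  subst (λ Y → extend Y a ≡ extend Y (r a)) (sym H≡Ch)
    (cancel-χᵇ (c h) _ _ (circuit-coefficient≢0 circuit c nontrivial vanishes h) H-terms-agree)
  where
  open ≡-Reasoning
  h : Fin (length C)
  h = index H∈C
  H≡Ch : H ≡ L.lookup C h
  H≡Ch = lookup-index H∈C
  g g' : Fin (length C) → ℚ
  g  j = c j *ℚ χᵇ (extend (L.lookup C j) a)
  g' j = c j *ℚ χᵇ (extend (L.lookup C j) (r a))
  other-terms-agree : ∀ j → j ≢ h → g j ≡ g' j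
  other-terms-agree j j≢h = cong (λ b → c j *ℚ χᵇ b) (others (L.lookup C j) (∈-lookup j)
    (λ Cj≡H → j≢h (lookup-injective unique j h (trans Cj≡H H≡Ch))) a)
  H-terms-agree : g h ≡ g' h
  H-terms-agree = begin
    g h                           ≡⟨ sym (ℚP.+-identityˡ (g h)) ⟩
    0ℚ +ℚ g h                     ≡⟨ cong (_+ℚ g h) (sym (combinationᵉ-vanishes C c vanishes (r a))) ⟩
    sumℚ (length C) g' +ℚ g h     ≡⟨ sym (sumℚ-exchange (length C) g g' h other-terms-agree) ⟩
    sumℚ (length C) g +ℚ g' h     ≡⟨ cong (_+ℚ g' h) (combinationᵉ-vanishes C c vanishes a) ⟩
    0ℚ +ℚ g' h                    ≡⟨ ℚP.+-identityˡ (g' h) ⟩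
    g' h                          ∎

mapCoefficients : ∀ {A B : Set} (T : A → B) (S : List A) → (Fin (length S) → ℚ) → Fin (length (L.map T S)) → ℚ
mapCoefficients T (X ∷ˡ S) c fzero    = c fzero
mapCoefficients T (X ∷ˡ S) c (fsuc j) = mapCoefficients T S (c ∘ fsuc) j

mapCoefficients-sum : ∀ {A B : Set} (T : A → B) (S : List A) c (G : A → ℚ) (G' : B → ℚ) → (∀ X → G' (T X) ≡ G X) →
  sumℚ (length (L.map T S)) (λ j → mapCoefficients T S c j *ℚ G' (L.lookup (L.map T S) j)) ≡
  sumℚ (length S) (λ j → c j *ℚ G (L.lookup S j))
mapCoefficients-sum T []ˡ       c G G' G'∘T≗G = refl
mapCoefficients-sum T (X ∷ˡ S) c G G' G'∘T≗G =
  cong₂ _+ℚ_ (cong (c fzero *ℚ_) (G'∘T≗G X)) (mapCoefficients-sum T S (c ∘ fsuc) G G' G'∘T≗G)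

mapCoefficients-nontrivial : ∀ {A B : Set} (T : A → B) (S : List A) c →
  ∃ (λ j → c j ≢ 0ℚ) → ∃ (λ j → mapCoefficients T S c j ≢ 0ℚ)
mapCoefficients-nontrivial T (X ∷ˡ S) c (fzero  , c0≢0) = fzero , c0≢0
mapCoefficients-nontrivial T (X ∷ˡ S) c (fsuc j , cj≢0) with mapCoefficients-nontrivial T S (c ∘ fsuc) (j , cj≢0)
... | j' , c'j'≢0 = fsuc j' , c'j'≢0

-- Dependence is preserved by a map T each of whose coordinates is a coordinate
-- of the extension: y ∈ T X ⟺ pos y ∈ X (the dummy n+1 giving the zero functional).
dependent-transport : ∀ {n ñ} (T : Subset n → Subset ñ) (pos : Fin ñ → Fin (suc n)) →
  (∀ X y → lookup (T X) y ≡ extend X (pos y)) → ∀ S → Dependent S → Dependent (L.map T S)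
dependent-transport T pos coordinates S (c , nontrivial , vanishes) =
  mapCoefficients T S c , mapCoefficients-nontrivial T S c nontrivial , λ y →
  trans (mapCoefficients-sum T S c (λ X → χᵇ (extend X (pos y))) (λ X̃ → χ X̃ y) (λ X → cong χᵇ (coordinates X y)))
        (combinationᵉ-vanishes S c vanishes (pos y))


-- Transport of circuits

sublist-of-map : ∀ {A B : Set} (g : A → B) (C : List A) {S̃ : List B} → S̃ ⊑ L.map g C →
  Σ (List A) λ S → S ⊑ C × S̃ ≡ L.map g S
sublist-of-map g []ˡ       []        = []ˡ , [] , refl
sublist-of-map g (X ∷ˡ C) (_ ∷ʳ S̃⊑) with sublist-of-map g C S̃⊑
... | S , S⊑C , refl = S , X ∷ʳ S⊑C , refl
sublist-of-map g (X ∷ˡ C) (refl ∷ S̃⊑) with sublist-of-map g C S̃⊑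
... | S , S⊑C , refl = X ∷ˡ S , refl ∷ S⊑C , refl

circuit-transport : ∀ {n ñ} (T : Subset n → Subset ñ) (T⁻¹ : Subset ñ → Subset n) {C : List (Subset n)} →
  (∀ X → X ∈ˡ C → T⁻¹ (T X) ≡ X) →
  (∀ S → Dependent S → Dependent (L.map T S)) →
  (∀ S̃ → Dependent S̃ → Dependent (L.map T⁻¹ S̃)) →
  (∀ X → X ∈ˡ C → Nonempty X → Nonempty (T X)) →
  IsCircuit C → IsCircuit (L.map T C)
circuit-transport T T⁻¹ {C} retract T-dep T⁻¹-dep T-nonempty (unique , nonempty , dependent , minimal) =
  UniqueP.map⁻ (subst Unique (sym (round-trip ⊆-refl)) unique) ,
  AllP.map⁺ (All.tabulate (λ X∈C → T-nonempty _ X∈C (All.lookup nonempty X∈C))) ,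
  T-dep C dependent ,
  minimal'
  where
  round-trip : ∀ {S} → S ⊑ C → L.map T⁻¹ (L.map T S) ≡ S
  round-trip S⊑C = trans (sym (LP.map-∘ _)) (LP.map-id-local (All.tabulate (λ X∈S → retract _ (Any-resp-⊆ S⊑C X∈S))))
  minimal' : ∀ S̃ → S̃ ⊑ L.map T C → length S̃ < length (L.map T C) → ¬ Dependent S̃
  minimal' S̃ S̃⊑TC shorter S̃-dep with sublist-of-map T C S̃⊑TC
  ... | S , S⊑C , refl = minimal S S⊑C (subst₂ _<_ (LP.length-map T S) (LP.length-map T C) shorter)
                                     (subst Dependent (round-trip S⊑C) (T⁻¹-dep (L.map T S) S̃-dep))


module Transport {K n ñ : ℕ} (p : Fin (suc n) → Fin (suc K)) (lp : IsLabelledPartition p)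
                 (p̃ : Fin (suc ñ) → Fin (suc K)) (lp̃ : IsLabelledPartition p̃) where

  open LabelledPartition p lp
  private module P̃ = LabelledPartition p̃ lp̃

  T : Subset n → Subset ñ
  T X = realise p̃ (label X)

  T⁻¹ : Subset ñ → Subset n
  T⁻¹ Y = realise p (P̃.label Y)

  T-realise : ∀ L → L (fromℕ K) ≡ false → T (realise p L) ≡ realise p̃ L
  T-realise L last = tabulate-cong (λ y → label-realise L last (p̃ (inject₁ y)))

  T-retract : ∀ {X} → Saturated X → T⁻¹ (T X) ≡ X
  T-retract {X} sat =
    trans (tabulate-cong (λ x → P̃.label-realise (label X) (label-last X sat) (p (inject₁ x)))) (realise-label X sat)

  T-injective : ∀ {X Y} → Saturated X → Saturated Y → T X ≡ T Y → X ≡ Y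
  T-injective {X} {Y} satX satY TX≡TY = trans (sym (T-retract satX)) (trans (cong T⁻¹ TX≡TY) (T-retract satY))

  T-nonempty : ∀ {X} → Saturated X → Nonempty X → Nonempty (T X)
  T-nonempty {X} sat (x , x∈X) = P̃.realise-nonempty (label X) (label-last X sat)
    (trans (sym (sat (inject₁ x))) (trans (extend-inner X x) ([]=⇒lookup x∈X)))

  T-monotone : ∀ {X Y} → Saturated X → Saturated Y → binVal X ≤ binVal Y → binVal (T X) ≤ binVal (T Y)
  T-monotone {X} {Y} satX satY X≤Y = realise-order-transport p lp p̃ lp̃ (label X) (label Y)
    (label-last X satX) (label-last Y satY) (subst₂ _≤_ (cong binVal (sym (realise-label X satX))) (cong binVal (sym (realise-label Y satY))) X≤Y)

  T-dependent : ∀ S → Dependent S → Dependent (L.map T S)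
  T-dependent = dependent-transport T (λ y → rep (p̃ (inject₁ y))) (λ X y → lookup∘tabulate _ y)

  T⁻¹-dependent : ∀ S̃ → Dependent S̃ → Dependent (L.map T⁻¹ S̃)
  T⁻¹-dependent = dependent-transport T⁻¹ (λ x → P̃.rep (p (inject₁ x))) (λ Y x → lookup∘tabulate _ x)

  -- A broken circuit consisting of unions of p-blocks is carried by T to a
  -- broken circuit: its removed element H is saturated as well, so the whole
  -- circuit is transported, together with its binary maximum.
  broken-circuit-transport : (B : List (Subset n)) → (∀ X → X ∈ˡ B → Saturated X) →
    IsBrokenCircuit n B → IsBrokenCircuit ñ (L.map T B)
  broken-circuit-transport B B-saturated (C , H , circuit , H∈C , H-max , B≡C∖H) =
    L.map T C , T H ,
    circuit-transport T T⁻¹ (λ X X∈C → T-retract {X} (saturated X X∈C)) T-dependent T⁻¹-dependent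
      (λ X X∈C → T-nonempty {X} (saturated X X∈C)) circuit ,
    ∈-map⁺ T H∈C , TH-max , λ X̃ → in-TB⇒ X̃ , ⇒in-TB X̃
    where
    others-saturated : ∀ X → X ∈ˡ C → X ≢ H → Saturated X
    others-saturated X X∈C X≢H = B-saturated X (proj₂ (B≡C∖H X) X∈C X≢H)

    H-saturated : Saturated H
    H-saturated = circuit-member-invariant (rep ∘ p) circuit H∈C others-saturated

    saturated : ∀ X → X ∈ˡ C → Saturated X
    saturated X X∈C with ≡-dec _≟ᵇ_ X H
    ... | yes refl = H-saturated
    ... | no X≢H   = others-saturated X X∈C X≢H

    TH-max : ∀ X̃ → X̃ ∈ˡ L.map T C → binVal X̃ ≤ binVal (T H)
    TH-max X̃ X̃∈TC with ∈-map⁻ T X̃∈TC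
    ... | X , X∈C , refl = T-monotone {X} {H} (saturated X X∈C) H-saturated (H-max X X∈C)

    in-TB⇒ : ∀ X̃ → X̃ ∈ˡ L.map T B → X̃ ∈ˡ L.map T C × X̃ ≢ T H
    in-TB⇒ X̃ X̃∈TB with ∈-map⁻ T X̃∈TB
    ... | X , X∈B , refl with proj₁ (B≡C∖H X) X∈B
    ...   | X∈C , X≢H = ∈-map⁺ T X∈C , λ TX≡TH → X≢H (T-injective {X} {H} (B-saturated X X∈B) H-saturated TX≡TH)

    ⇒in-TB : ∀ X̃ → X̃ ∈ˡ L.map T C → X̃ ≢ T H → X̃ ∈ˡ L.map T B
    ⇒in-TB X̃ X̃∈TC X̃≢TH with ∈-map⁻ T X̃∈TC
    ... | X , X∈C , refl = ∈-map⁺ T (proj₂ (B≡C∖H X) X∈C (λ X≡H → X̃≢TH (cong T X≡H)))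


-- The sets A_j of a prototype

buildingBlock : ∀ {i K} → (Fin K → Subset i) → Fin i → Fin (suc K) → Bool
buildingBlock {K = K} f j m = anyFin K (λ ℓ → lookup (f ℓ) j ∧ (toℕ m ≡ᵇ toℕ ℓ))

anyFin-false : ∀ m (g : Fin m → Bool) → (∀ ℓ → g ℓ ≡ false) → anyFin m g ≡ false
anyFin-false zero    g none = refl
anyFin-false (suc m) g none rewrite none fzero = anyFin-false m (g ∘ fsuc) (none ∘ fsuc)

buildingBlock-last : ∀ {i K} (f : Fin K → Subset i) j → buildingBlock f j (fromℕ K) ≡ false
buildingBlock-last {K = K} f j = anyFin-false K _ not-last
  where
  not-last : ∀ ℓ → lookup (f ℓ) j ∧ (toℕ (fromℕ K) ≡ᵇ toℕ ℓ) ≡ false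
  not-last ℓ rewrite toℕ-fromℕ K with K ≡ᵇ toℕ ℓ in K≡ℓ
  ... | true  = ⊥-elim (<-irrefl (sym (≡ᵇ⇒≡′ K≡ℓ)) (toℕ<n ℓ))
  ... | false = ∧-zeroʳ _

Afπ-transport : ∀ {i K n ñ} (f : Fin K → Subset i)
  (p : Fin (suc n) → Fin (suc K)) (lp : IsLabelledPartition p)
  (p̃ : Fin (suc ñ) → Fin (suc K)) (lp̃ : IsLabelledPartition p̃) →
  L.map (Transport.T p lp p̃ lp̃) (Afπ f p) ≡ Afπ f p̃
Afπ-transport f p lp p̃ lp̃ =
  trans (LP.map-tabulate _ T) (LP.tabulate-cong (λ j → T-realise (buildingBlock f j) (buildingBlock-last f j)))
  where open Transport p lp p̃ lp̃

Afπ-saturated : ∀ {i K n} (f : Fin K → Subset i) (p : Fin (suc n) → Fin (suc K)) (lp : IsLabelledPartition p) →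
  ∀ X → X ∈ˡ Afπ f p → LabelledPartition.Saturated p lp X
Afπ-saturated f p lp X X∈A with ∈-tabulate⁻ X∈A
... | j , refl = LabelledPartition.realise-saturated p lp (buildingBlock f j) (buildingBlock-last f j)


proposition5p1 : (i k : ℕ) → 1 ≤ i → i + 1 ≤ k → k ≤ 2 ^ i →
    (f : Fin (k ∸ 1) → Subset i) → IsPrototype k f →
    Σ ℕ (λ n → 1 ≤ n × Σ (Fin (suc n) → Fin k) (λ p →
      IsLabelledPartition p × IsBrokenCircuit n (Afπ f p))) →
    (ñ : ℕ) → 1 ≤ ñ → (p̃ : Fin (suc ñ) → Fin k) → IsLabelledPartition p̃ →
    IsBrokenCircuit ñ (Afπ f p̃)
proposition5p1 i zero    _ _ _ f _ _ ñ _ p̃ _ with p̃ fzero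
... | ()
proposition5p1 i (suc K) _ _ _ f _ (n , _ , p , lp , broken) ñ _ p̃ lp̃ =
  subst (IsBrokenCircuit ñ) (Afπ-transport f p lp p̃ lp̃)
    (Transport.broken-circuit-transport p lp p̃ lp̃ (Afπ f p) (Afπ-saturated f p lp) broken)
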